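{- Let $w$ be a 2D word of size $(m,n)$ with $m,n\ge 2$ over an alphabet $\Sigma$, let $x_1,\dots,x_n\in\Sigma$, and let $w'$ be the 2D word of size $(m+1,n)$ obtained by appending the row $x_1x_2\cdots x_n$ below $w$. Then there is at most one 2D palindrome of size $(t,n)$, for some $t\ge 1$, that is a factor of $w'$ but not a factor of $w$. The same holds with "2D palindrome" replaced by "HV-palindrome".
   Context: A 2D word of size $(m,n)$ over a finite alphabet $\Sigma$ is an $m\times n$ array $w=[w_{i,j}]$ with entries in $\Sigma$; its rows and columns are 1D words. A factor of $w$ is a sub-array of consecutive rows and columns, considered as a 2D word. A 1D word is a palindrome if it equals its reversal. The reverse of $w$ is $w^R=[w_{m-i+1,\,n-j+1}]_{i,j}$; $w$ is a 2D palindrome if $w=w^R$, and an HV-palindrome if each of its rows and each of its columns is a 1D palindrome. -}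

module Defs where

open import Data.Nat using (ℕ; zero; suc; _+_; _≤_; _<_)
open import Data.Maybe using (Maybe; just; nothing)
open import Data.Vec using (Vec; []; _∷_; reverse; map; transpose; _∷ʳ_)
open import Data.Vec.Relation.Unary.All using (All)
open import Data.Product using (∃; _×_; Σ)
open import Data.Empty using (⊥)
open import Relation.Binary.PropositionalEquality using (_≡_)

record Word2 (A : Set) : Set where
  constructor word
  field
    rows : ℕ
    cols : ℕ
    arr  : Vec (Vec A cols) rows
open Word2 public

lookupℕ : ∀ {A : Set} {n} → Vec A n → ℕ → Maybe A
lookupℕ []       _       = nothing
lookupℕ (x ∷ xs) zero    = just x
lookupℕ (x ∷ xs) (suc i) = lookupℕ xs i

maybeBind : ∀ {A B : Set} → Maybe A → (A → Maybe B) → Maybe B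
maybeBind nothing  f = nothing
maybeBind (just a) f = f a

-- entry (i , j) of a 2D word (0-based indices)
entry : ∀ {A : Set} → Word2 A → ℕ → ℕ → Maybe A
entry w i j = maybeBind (lookupℕ (arr w) i) (λ row → lookupℕ row j)

IsFactor : ∀ {A : Set} → Word2 A → Word2 A → Set
IsFactor p w =
  ∃ λ i → ∃ λ j → (i + rows p ≤ rows w) × (j + cols p ≤ cols w) ×
    (∀ r c → r < rows p → c < cols p → entry p r c ≡ entry w (i + r) (j + c))

Palindrome : ∀ {A : Set} {n} → Vec A n → Set
Palindrome v = v ≡ reverse v

reverse2 : ∀ {A : Set} → Word2 A → Word2 A
reverse2 (word m n a) = word m n (reverse (map reverse a))

Palindrome2D : ∀ {A : Set} → Word2 A → Set
Palindrome2D w = w ≡ reverse2 w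

HVPalindrome : ∀ {A : Set} → Word2 A → Set
HVPalindrome w = All Palindrome (arr w) × All Palindrome (transpose (arr w))

AtMostOneNewFactor : ∀ {A : Set} → (Word2 A → Set) → ℕ → Word2 A → Word2 A → Set
AtMostOneNewFactor P n w w' =
  ∀ (p q : Word2 _) →
    cols p ≡ n → cols q ≡ n → 1 ≤ rows p → 1 ≤ rows q →
    P p → P q →
    IsFactor p w' → IsFactor q w' →
    (IsFactor p w → ⊥) → (IsFactor q w → ⊥) →
    p ≡ q

-- A new factor of full width n must contain the appended row, so it is a block of bottom
-- rows of w′ and is determined by its height. Both kinds of palindrome are invariant under
-- the row reflection r ↦ t − 1 − r combined with a fixed map on columns. If a shorter new
-- palindrome p were a bottom block of a longer one q, reflecting inside p and then inside q
-- would show that p also occurs as the top block of q, which lies inside w.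
module Submission where

open import Defs
open import Data.Nat using (ℕ; _≤_)
open import Data.Fin using (Fin)
open import Data.Vec using (Vec; _∷ʳ_)
open import Data.Product using (_×_)

open import Data.Nat using (zero; suc; _+_; _∸_; _<_; s≤s; z<s)
open import Data.Nat.Properties
open import Data.Fin using (fromℕ<)
open import Data.Maybe as Maybe using (Maybe; just; nothing)
open import Data.Maybe.Properties using (just-injective)
open import Data.Vec using ([]; _∷_; lookup; reverse; map; transpose; replicate; _⊛_)
open import Data.Vec.Properties using (reverse-∷; lookup-⊛; lookup-replicate)
open import Data.Vec.Relation.Unary.All.Properties using (lookup⁺)
open import Data.Product using (_,_)
open import Data.Sum using (inj₁; inj₂)
open import Data.Empty using (⊥-elim)
open import Function using (_∘_; _$_; id)
open import Relation.Nullary using (¬_)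
open import Relation.Binary.PropositionalEquality
open import Relation.Binary.Definitions using (tri<; tri≈; tri>)

private variable
  A B C : Set
  m n t t′ i : ℕ

[m∸n]+[n∸o]≡m∸o : ∀ {m n o} → o ≤ n → n ≤ m → (m ∸ n) + (n ∸ o) ≡ m ∸ o
[m∸n]+[n∸o]≡m∸o {m} {n} {o} o≤n n≤m = begin
  (m ∸ n) + (n ∸ o)   ≡⟨ +-∸-assoc (m ∸ n) o≤n ⟨
  (m ∸ n) + n ∸ o     ≡⟨ cong (_∸ o) (m∸n+n≡m n≤m) ⟩
  m ∸ o               ∎
  where open ≡-Reasoning

maybeBind-map : (f : A → B) (g : B → Maybe C) (mx : Maybe A) →
                maybeBind (Maybe.map f mx) g ≡ maybeBind mx (g ∘ f)
maybeBind-map f g nothing  = refl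
maybeBind-map f g (just x) = refl

maybeBind-cong : (mx : Maybe A) {f g : A → Maybe B} → (∀ x → f x ≡ g x) →
                 maybeBind mx f ≡ maybeBind mx g
maybeBind-cong nothing  eq = refl
maybeBind-cong (just x) eq = eq x

lookupℕ-fromℕ< : (v : Vec A n) (i<n : i < n) → lookupℕ v i ≡ just (lookup v (fromℕ< i<n))
lookupℕ-fromℕ< {i = zero}  (x ∷ v) _         = refl
lookupℕ-fromℕ< {i = suc i} (x ∷ v) (s≤s i<n) = lookupℕ-fromℕ< v i<n

lookupℕ-map : (f : A → B) (v : Vec A n) (i : ℕ) → lookupℕ (map f v) i ≡ Maybe.map f (lookupℕ v i)
lookupℕ-map f []      i       = refl
lookupℕ-map f (x ∷ v) zero    = refl
lookupℕ-map f (x ∷ v) (suc i) = lookupℕ-map f v i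

lookupℕ-∷ʳ-< : (v : Vec A n) (x : A) → i < n → lookupℕ (v ∷ʳ x) i ≡ lookupℕ v i
lookupℕ-∷ʳ-< {i = zero}  (y ∷ v) x _         = refl
lookupℕ-∷ʳ-< {i = suc i} (y ∷ v) x (s≤s i<n) = lookupℕ-∷ʳ-< v x i<n

lookupℕ-∷ʳ-last : (v : Vec A n) (x : A) → lookupℕ (v ∷ʳ x) n ≡ just x
lookupℕ-∷ʳ-last []      x = refl
lookupℕ-∷ʳ-last (y ∷ v) x = lookupℕ-∷ʳ-last v x

lookupℕ-reverse : (v : Vec A n) → i < n → lookupℕ (reverse v) i ≡ lookupℕ v (n ∸ suc i)
lookupℕ-reverse {n = suc n} {i} (x ∷ v) (s≤s i≤n) rewrite reverse-∷ x v
  with m≤n⇒m<n∨m≡n i≤n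
... | inj₁ i<n = begin
  lookupℕ (reverse v ∷ʳ x) i    ≡⟨ lookupℕ-∷ʳ-< (reverse v) x i<n ⟩
  lookupℕ (reverse v) i         ≡⟨ lookupℕ-reverse v i<n ⟩
  lookupℕ v (n ∸ suc i)         ≡⟨ cong (lookupℕ (x ∷ v)) (+-∸-assoc 1 i<n) ⟨
  lookupℕ (x ∷ v) (suc n ∸ suc i) ∎
  where open ≡-Reasoning
... | inj₂ refl rewrite n∸n≡0 i = lookupℕ-∷ʳ-last (reverse v) x

lookupℕ-ext : (u v : Vec A n) → (∀ {i} → i < n → lookupℕ u i ≡ lookupℕ v i) → u ≡ v
lookupℕ-ext []      []      eq = refl
lookupℕ-ext (x ∷ u) (y ∷ v) eq =
  cong₂ _∷_ (just-injective (eq z<s)) (lookupℕ-ext u v (eq ∘ s≤s))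

entry-ext : (a b : Vec (Vec A n) t) →
            (∀ {r c} → r < t → c < n → entry (word t n a) r c ≡ entry (word t n b) r c) →
            a ≡ b
entry-ext []      []      eq = refl
entry-ext (u ∷ a) (v ∷ b) eq =
  cong₂ _∷_ (lookupℕ-ext u v (eq z<s)) (entry-ext a b (eq ∘ s≤s))

entry-reverse2 : (a : Vec (Vec A n) t) {r c : ℕ} → r < t → c < n →
                 entry (reverse2 (word t n a)) r c ≡ entry (word t n a) (t ∸ suc r) (n ∸ suc c)
entry-reverse2 {n = n} {t} a {r} {c} r<t c<n = begin
  maybeBind (lookupℕ (reverse (map reverse a)) r) (λ row → lookupℕ row c)
    ≡⟨ cong (λ z → maybeBind z _) (lookupℕ-reverse (map reverse a) r<t) ⟩
  maybeBind (lookupℕ (map reverse a) (t ∸ suc r)) (λ row → lookupℕ row c)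
    ≡⟨ cong (λ z → maybeBind z _) (lookupℕ-map reverse a (t ∸ suc r)) ⟩
  maybeBind (Maybe.map reverse (lookupℕ a (t ∸ suc r))) (λ row → lookupℕ row c)
    ≡⟨ maybeBind-map reverse _ (lookupℕ a (t ∸ suc r)) ⟩
  maybeBind (lookupℕ a (t ∸ suc r)) (λ row → lookupℕ (reverse row) c)
    ≡⟨ maybeBind-cong (lookupℕ a (t ∸ suc r)) (λ row → lookupℕ-reverse row c<n) ⟩
  maybeBind (lookupℕ a (t ∸ suc r)) (λ row → lookupℕ row (n ∸ suc c))
    ∎
  where open ≡-Reasoning

column : Vec (Vec A n) m → Fin n → Vec A m
column a j = map (λ row → lookup row j) a

lookup-transpose : (a : Vec (Vec A n) m) (j : Fin n) → lookup (transpose a) j ≡ column a j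
lookup-transpose []      j = lookup-replicate j []
lookup-transpose {n = n} (u ∷ a) j = begin
  lookup ((replicate n _∷_ ⊛ u) ⊛ transpose a) j
    ≡⟨ lookup-⊛ j (replicate n _∷_ ⊛ u) (transpose a) ⟩
  lookup (replicate n _∷_ ⊛ u) j (lookup (transpose a) j)
    ≡⟨ cong (_$ lookup (transpose a) j) (lookup-⊛ j (replicate n _∷_) u) ⟩
  lookup (replicate n _∷_) j (lookup u j) (lookup (transpose a) j)
    ≡⟨ cong (λ f → f (lookup u j) (lookup (transpose a) j)) (lookup-replicate j _∷_) ⟩
  lookup u j ∷ lookup (transpose a) j
    ≡⟨ cong (lookup u j ∷_) (lookup-transpose a j) ⟩
  lookup u j ∷ column a j
    ∎
  where open ≡-Reasoning

entry-column : (a : Vec (Vec A n) m) (r : ℕ) {c : ℕ} (c<n : c < n) →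
               entry (word m n a) r c ≡ lookupℕ (column a (fromℕ< c<n)) r
entry-column []      r       c<n = refl
entry-column (u ∷ a) zero    c<n = lookupℕ-fromℕ< u c<n
entry-column (u ∷ a) (suc r) c<n = entry-column a r c<n

RowReflecting : (Word2 A → Set) → ℕ → (ℕ → ℕ) → Set
RowReflecting {A} P n σ =
  ∀ {t} (a : Vec (Vec A n) t) → P (word t n a) → ∀ {r c} → r < t → c < n →
  entry (word t n a) r c ≡ entry (word t n a) (t ∸ suc r) (σ c)

palindrome2D-rowReflecting : RowReflecting {A} Palindrome2D n (λ c → n ∸ suc c)
palindrome2D-rowReflecting a pal {r} {c} r<t c<n =
  trans (cong (λ v → entry v r c) pal) (entry-reverse2 a r<t c<n)

hvPalindrome-rowReflecting : RowReflecting {A} HVPalindrome n id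
hvPalindrome-rowReflecting {t = t} a (_ , columnsPal) {r} {c} r<t c<n = begin
  entry (word t _ a) r c                      ≡⟨ entry-column a r c<n ⟩
  lookupℕ col r                               ≡⟨ cong (λ v → lookupℕ v r) colPal ⟩
  lookupℕ (reverse col) r                     ≡⟨ lookupℕ-reverse col r<t ⟩
  lookupℕ col (t ∸ suc r)                     ≡⟨ entry-column a (t ∸ suc r) c<n ⟨
  entry (word t _ a) (t ∸ suc r) c            ∎
  where
  open ≡-Reasoning
  col = column a (fromℕ< c<n)
  colPal : Palindrome col
  colPal = subst Palindrome (lookup-transpose a (fromℕ< c<n)) (lookup⁺ columnsPal (fromℕ< c<n))

module _ (w : Vec (Vec A n) m) (x : Vec A n) where

  private
    W W′ : Word2 A
    W  = word m n w
    W′ = word (suc m) n (w ∷ʳ x)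

  OccursAt : ℕ → Vec (Vec A n) t → Set
  OccursAt {t} i a = ∀ {r c} → r < t → c < n → entry (word t n a) r c ≡ entry W′ (i + r) c

  IsBottomBlock : Vec (Vec A n) t → Set
  IsBottomBlock {t} a = t ≤ suc m × OccursAt (suc m ∸ t) a

  occursAt⇒isFactor : (a : Vec (Vec A n) t) → i + t ≤ m → OccursAt i a → IsFactor (word t n a) W
  occursAt⇒isFactor {i = i} a i+t≤m occ = i , 0 , i+t≤m , ≤-refl , λ r c r<t c<n →
    trans (occ r<t c<n)
          (cong (λ z → maybeBind z (λ row → lookupℕ row c))
                (lookupℕ-∷ʳ-< w x (≤-trans (+-monoʳ-< i r<t) i+t≤m)))

  newFactor⇒isBottomBlock : (a : Vec (Vec A n) t) →
    IsFactor (word t n a) W′ → ¬ IsFactor (word t n a) W → IsBottomBlock a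
  newFactor⇒isBottomBlock {t} a (i , j , i+t≤1+m , j+n≤n , occ) new
    with refl ← n≤0⇒n≡0 (+-cancelʳ-≤ n j 0 j+n≤n) = t≤1+m , occ′
    where
    i+t≡1+m : i + t ≡ suc m
    i+t≡1+m = ≤-antisym i+t≤1+m (≰⇒> (λ i+t≤m → new (occursAt⇒isFactor a i+t≤m (occ _ _))))
    t≤1+m : t ≤ suc m
    t≤1+m = subst (t ≤_) i+t≡1+m (m≤n+m t i)
    occ′ : OccursAt (suc m ∸ t) a
    occ′ = subst (λ k → OccursAt (k ∸ t) a) i+t≡1+m
             (subst (λ k → OccursAt k a) (sym (m+n∸n≡m i t)) (occ _ _))

  isBottomBlock-unique : (a b : Vec (Vec A n) t) → IsBottomBlock a → IsBottomBlock b → a ≡ b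
  isBottomBlock-unique a b (_ , occa) (_ , occb) =
    entry-ext a b (λ r<t c<n → trans (occa r<t c<n) (sym (occb r<t c<n)))

  module _ {P : Word2 A → Set} {σ : ℕ → ℕ}
           (reflecting : RowReflecting P n σ) (σ-< : ∀ {c} → c < n → σ c < n) where

    shorter-bottomBlock-isFactor : (a : Vec (Vec A n) t) (b : Vec (Vec A n) t′) →
      P (word t n a) → P (word t′ n b) → IsBottomBlock a → IsBottomBlock b → t < t′ →
      IsFactor (word t n a) W
    shorter-bottomBlock-isFactor {t} {t′} a b Pa Pb (t≤1+m , occa) (t′≤1+m , occb) t<t′ =
      occursAt⇒isFactor a fits occ
      where
      i′ = suc m ∸ t′
      fits : i′ + t ≤ m
      fits = ≤-pred (subst (suc (i′ + t) ≤_) (m∸n+n≡m t′≤1+m) (+-monoʳ-< i′ t<t′))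
      mirrored : ∀ {r} → r < t → (suc m ∸ t) + (t ∸ suc r) ≡ i′ + (t′ ∸ suc r)
      mirrored r<t = trans ([m∸n]+[n∸o]≡m∸o r<t t≤1+m)
                           (sym ([m∸n]+[n∸o]≡m∸o (<-trans r<t t<t′) t′≤1+m))
      occ : OccursAt i′ a
      occ {r} {c} r<t c<n = begin
        entry (word t n a) r c                          ≡⟨ reflecting a Pa r<t c<n ⟩
        entry (word t n a) (t ∸ suc r) (σ c)            ≡⟨ occa (∸-monoʳ-< z<s r<t) (σ-< c<n) ⟩
        entry W′ ((suc m ∸ t) + (t ∸ suc r)) (σ c)      ≡⟨ cong (λ k → entry W′ k (σ c)) (mirrored r<t) ⟩
        entry W′ (i′ + (t′ ∸ suc r)) (σ c)              ≡⟨ occb (∸-monoʳ-< z<s r<t′) (σ-< c<n) ⟨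
        entry (word t′ n b) (t′ ∸ suc r) (σ c)          ≡⟨ reflecting b Pb r<t′ c<n ⟨
        entry (word t′ n b) r c                         ≡⟨ occb r<t′ c<n ⟩
        entry W′ (i′ + r) c                             ∎
        where
        open ≡-Reasoning
        r<t′ = <-trans r<t t<t′

    atMostOneNewFactor : AtMostOneNewFactor P n W W′
    atMostOneNewFactor (word t _ a) (word t′ _ b) refl refl _ _ Pa Pb Fa Fb newA newB
      with newFactor⇒isBottomBlock a Fa newA | newFactor⇒isBottomBlock b Fb newB | <-cmp t t′
    ... | bottomA | bottomB | tri< t<t′ _ _ =
      ⊥-elim (newA (shorter-bottomBlock-isFactor a b Pa Pb bottomA bottomB t<t′))
    ... | bottomA | bottomB | tri> _ _ t′<t =
      ⊥-elim (newB (shorter-bottomBlock-isFactor b a Pb Pa bottomB bottomA t′<t))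
    ... | bottomA | bottomB | tri≈ _ refl _ =
      cong (word t _) (isBottomBlock-unique a b bottomA bottomB)

corollary5p4 : ∀ (k m n : ℕ) → 2 ≤ m → 2 ≤ n →
    (w : Vec (Vec (Fin k) n) m) → (x : Vec (Fin k) n) →
    AtMostOneNewFactor Palindrome2D n (word m n w) (word _ n (w ∷ʳ x))
    × AtMostOneNewFactor HVPalindrome n (word m n w) (word _ n (w ∷ʳ x))
corollary5p4 k m n _ _ w x =
  atMostOneNewFactor w x palindrome2D-rowReflecting (λ c<n → ∸-monoʳ-< z<s c<n) ,
  atMostOneNewFactor w x hvPalindrome-rowReflecting id
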